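{- Consider an instance of 2NC-TAP, let $\lambda=\max\{|E(T(\ell))| : \ell\in L(G)\}$, and run the greedy algorithm described in the context, producing the dual vector $y$ defined in the context. Then $\frac{1}{H(\lambda-1)}\,y$ is a feasible solution of the linear program \[ (D)\quad \max \sum_{u\in\mathrm{nonleaf}(T)}\ \sum_{\mathcal{P}\in\Pi(u)} (|\mathcal{P}|-1)\,y_{\mathcal{P}} \quad\text{s.t.}\quad \sum_{u\in\mathrm{nonleaf}(T)}\ \sum_{\substack{\mathcal{P}\in\Pi(u)\\ \ell \text{ crosses } \mathcal{P}}} y_{\mathcal{P}} \le \mathit{cost}(\ell)\ \ \forall \ell\in L(G),\quad y\ge 0. \]
   Context: 2NC-TAP instance: a simple undirected graph $G=(V,E)$ that is 2-node connected (at least 3 nodes, connected, and remains connected after deleting any one node), nonnegative costs $\mathit{cost}\in\mathbb{R}_+^E$, and a spanning tree $T$ of $G$ all of whose edges have cost $0$. The edges of $E(G)\setminus E(T)$ are called links; $L(G)$ is the set of links. For a link $\ell$, $T(\ell)$ is the path in $T$ between the end nodes of $\ell$. $H(k)=1+\frac12+\dots+\frac1k$ is the $k$-th harmonic number. $\mathrm{nonleaf}(T)$ is the set of non-leaf nodes of $T$. For $u\in\mathrm{nonleaf}(T)$, $\pi(\mathrm{comps}(T-u))$ is the partition of $V\setminus\{u\}$ into the node sets of the connected components of $T-u$, $\nu(u)$ is its number of parts, and $\Pi(u)$ is the set of partitions of $V\setminus\{u\}$ of which $\pi(\mathrm{comps}(T-u))$ is a refinement; $|\mathcal{P}|$ is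 the number of parts of $\mathcal{P}$. A link $\ell$ crosses a partition $\mathcal{P}$ of $V\setminus\{u\}$ if both end nodes of $\ell$ lie in $V\setminus\{u\}$ and in different parts of $\mathcal{P}$. Greedy algorithm: start with $F=\emptyset$ and $\mathrm{wgt}(\mathcal{P})=0$ for every $\mathcal{P}\in\bigcup_{u}\Pi(u)$. In iteration $i=1,2,\dots$, let $F^i$ be the set of links picked so far; for each $u\in\mathrm{nonleaf}(T)$ let $\mathcal{P}^i_u\in\Pi(u)$ be the partition of $V\setminus\{u\}$ into node sets of the connected components of $(T\cup F^i)-u$; for each link $\ell$ let $\mathrm{inc}^i(\ell)=\{\mathcal{P}^i_u : u\in\mathrm{nonleaf}(T),\ \ell \text{ crosses } \mathcal{P}^i_u\}$. The iteration picks a link $\ell^*$ with $\mathrm{inc}^i(\ell^*)\ne\emptyset$ minimizing $\mathit{cost}(\ell^*)/|\mathrm{inc}^i(\ell^*)|$, sets $\mathrm{wgt}(\mathcal{P}^i_u)=\mathit{cost}(\ell^*)/|\mathrm{inc}^i(\ell^*)|$ for every $\mathcal{P}^i_u\in\mathrm{inc}^i(\ell^*)$, and sets $F^{i+1}=F^i\cup\{\ell^*\}$. The algorithm stops when $T\cup F$ is a 2-node connected spanning subgraph of $G$. Dual vector: for each $u\in\mathrm{nonleaf}(T)$, let $\mathcal{P}^{(1)}_u,\dots,\mathcal{P}^{(\nu(u)-1)}_u$ be the partitions of $\Pi(u)$ that are assigned a weight during the run, in the order in which they are assigned. Define $y(\mathcal{P}^{(1)}_u)=\mathrm{wgt}(\mathcal{P}^{(1)}_u)$,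 $y(\mathcal{P}^{(j)}_u)=\mathrm{wgt}(\mathcal{P}^{(j)}_u)-\mathrm{wgt}(\mathcal{P}^{(j-1)}_u)$ for $j=2,\dots,\nu(u)-1$, and $y(\mathcal{P})=0$ for all other $\mathcal{P}\in\Pi(u)$.
   Formalization: The link costs take values in the nonnegative rationals instead of $\mathbb{R}_+$. -}

module Defs where

open import Data.Nat using (ℕ; zero; suc; _∸_; _≤_; _≤ᵇ_)
open import Data.Fin using (Fin; _≟_; toℕ)
open import Data.Bool using (Bool; true; false; _∧_; _∨_; not; if_then_else_; T; _xor_)
open import Data.List using (List; []; _∷_; _++_; map; take; length; allFin; foldr; filterᵇ; lookup)
open import Data.Bool.ListAction using (any; all)
open import Data.Nat.ListAction using (sum)
open import Data.List.Relation.Unary.Any using (Any)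
open import Data.List.Relation.Unary.Unique.Propositional using (Unique)
open import Data.Product using (_×_; _,_; proj₁; proj₂; Σ; ∃)
open import Data.Sum using (_⊎_)
open import Data.Integer using (+_)
open import Data.Rational using (ℚ; 0ℚ; _+_; _*_; _-_; _/_) renaming (_≤_ to _≤ℚ_)
open import Relation.Nullary using (¬_)
open import Relation.Nullary.Decidable using (⌊_⌋)
open import Relation.Binary.PropositionalEquality using (_≡_; _≢_)

Edge : ℕ → Set
Edge n = Fin n × Fin n

EdgeList : ℕ → Set
EdgeList n = List (Edge n)

_==_ : ∀ {n} → Fin n → Fin n → Bool
x == y = ⌊ x ≟ y ⌋

SameEdge : ∀ {n} → Edge n → Edge n → Set
SameEdge (a , b) (c , d) = (a ≡ c × b ≡ d) ⊎ (a ≡ d × b ≡ c)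

Simple : ∀ {n} → EdgeList n → Set
Simple E = (∀ (i : Fin (length E)) → proj₁ (lookup E i) ≢ proj₂ (lookup E i))
         × (∀ (i j : Fin (length E)) → SameEdge (lookup E i) (lookup E j) → i ≡ j)

iter : ∀ {A : Set} → ℕ → (A → A) → A → A
iter zero    f a = a
iter (suc k) f a = f (iter k f a)

-- one step of closure of a node set S under edges of E, restricted to the
-- allowed nodes ok (used to delete a node)
step : ∀ {n} → EdgeList n → (Fin n → Bool) → (Fin n → Bool) → (Fin n → Bool)
step E ok S v = S v ∨ (ok v ∧ any (λ e → ((proj₁ e == v) ∧ S (proj₂ e)) ∨ ((proj₂ e == v) ∧ S (proj₁ e))) E)

-- conn E ok x y : x and y are allowed nodes and lie in the same connected
-- component of the graph (allowed nodes, edges of E between allowed nodes).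
-- (n iterations suffice, a path has at most n-1 edges.)
conn : ∀ {n} → EdgeList n → (Fin n → Bool) → Fin n → Fin n → Bool
conn {n} E ok x = iter n (step E ok) (λ v → ok x ∧ (v == x))

allNodes : ∀ {n} → Fin n → Bool
allNodes _ = true

notU : ∀ {n} → Fin n → Fin n → Bool
notU u v = not (v == u)

Connected : ∀ {n} → EdgeList n → (Fin n → Bool) → Set
Connected {n} E ok = ∀ (x y : Fin n) → T (ok x) → T (ok y) → T (conn E ok x y)

TwoNC : ∀ {n} → EdgeList n → Set
TwoNC {n} E = 3 ≤ n × Connected E allNodes × (∀ (u : Fin n) → Connected E (notU u))

IsSpanningTree : ∀ {n} → EdgeList n → Set
IsSpanningTree {n} E = Connected E allNodes × length E ≡ n ∸ 1

count : ∀ {n} → (Fin n → Bool) → ℕ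
count {n} p = sum (map (λ u → if p u then 1 else 0) (allFin n))

degree : ∀ {n} → EdgeList n → Fin n → ℕ
degree E u = sum (map (λ e → (if proj₁ e == u then 1 else 0) Data.Nat.+ (if proj₂ e == u then 1 else 0)) E)

nonleaf : ∀ {n} → EdgeList n → Fin n → Bool
nonleaf E u = 2 ≤ᵇ degree E u

Adj : ∀ {n} → EdgeList n → Fin n → Fin n → Set
Adj E x z = Any (λ e → SameEdge e (x , z)) E

data Walk {n} (E : EdgeList n) : Fin n → Fin n → List (Fin n) → Set where
  single : ∀ x → Walk E x x (x ∷ [])
  cons   : ∀ {x z y xs} → Adj E x z → Walk E z y xs → Walk E x y (x ∷ xs)

IsPath : ∀ {n} → EdgeList n → Fin n → Fin n → List (Fin n) → Set
IsPath E x y xs = Walk E x y xs × Unique xs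

-- c / k (used only for k ≥ 1)
ratio : ℚ → ℕ → ℚ
ratio c k = c * ((+ 1) / suc (k ∸ 1))

harmonic : ℕ → ℚ
harmonic zero    = 0ℚ
harmonic (suc k) = harmonic k + ((+ 1) / suc k)

sumℚ : List ℚ → ℚ
sumℚ = foldr _+_ 0ℚ

-- 2NC-TAP instance: nodes Fin n, tree edges tr (cost 0), links indexed by
-- Fin m with end nodes link j and cost cost j.

record Instance : Set where
  field
    n    : ℕ
    m    : ℕ
    tr   : EdgeList n
    link : Fin m → Edge n
    cost : Fin m → ℚ

  links : EdgeList n
  links = map link (allFin m)

  G : EdgeList n
  G = tr ++ links

record Is2NCTAP (I : Instance) : Set where
  open Instance I
  field
    simpleG   : Simple G
    twoNC-G   : TwoNC G
    spanning  : IsSpanningTree tr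
    costNonneg : ∀ (j : Fin m) → 0ℚ ≤ℚ cost j

module Greedy (I : Instance) (ls : List (Fin (Instance.m I))) where
  open Instance I

  -- F^i : first i picked links (iteration index 0-based: F 0 = ∅)
  F : ℕ → EdgeList n
  F i = map link (take i ls)

  -- P^i_u : x,y in same part iff same component of (T ∪ F^i) - u
  part : ℕ → Fin n → Fin n → Fin n → Bool
  part i u = conn (tr ++ F i) (notU u)

  crosses : ℕ → Fin n → Fin m → Bool
  crosses i u j = notU u (proj₁ (link j)) ∧ notU u (proj₂ (link j))
                  ∧ not (part i u (proj₁ (link j)) (proj₂ (link j)))

  inc : ℕ → Fin m → ℕ
  inc i j = count (λ u → nonleaf tr u ∧ crosses i u j)

  record IsGreedyRun : Set where
    field
      notDone  : ∀ (k : Fin (length ls)) → ¬ TwoNC (tr ++ F (toℕ k))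
      incPos   : ∀ (k : Fin (length ls)) → 1 ≤ inc (toℕ k) (lookup ls k)
      minimal  : ∀ (k : Fin (length ls)) (j : Fin m) → 1 ≤ inc (toℕ k) j →
                 ratio (cost (lookup ls k)) (inc (toℕ k) (lookup ls k))
                   ≤ℚ ratio (cost j) (inc (toℕ k) j)
      done     : TwoNC (tr ++ F (length ls))

  -- support of the dual vector y: entries (u , i , y(P^i_u)) for every
  -- partition P^i_u that is assigned a weight (in iteration i);
  -- w u = last weight assigned to a partition of Π(u) (0 if none yet)
  go : ℕ → List (Fin m) → (Fin n → ℚ) → List (Fin n × ℕ × ℚ)
  go i []      w = []
  go i (j ∷ r) w =
    map (λ u → (u , i , wt - w u)) (filterᵇ hit (allFin n))
      ++ go (suc i) r (λ u → if hit u then wt else w u)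
    where
      wt : ℚ
      wt = ratio (cost j) (inc i j)
      hit : Fin n → Bool
      hit u = nonleaf tr u ∧ crosses i u j

  entries : List (Fin n × ℕ × ℚ)
  entries = go 0 ls (λ _ → 0ℚ)

  -- a partition of V \ {u} given by its "same part" relation, equal to P^i_u
  samePart : Fin n → (Fin n → Fin n → Bool) → ℕ → Bool
  samePart u P i = all (λ x → all (λ y → not (notU u x ∧ notU u y) ∨ not (P x y xor part i u x y)) (allFin n)) (allFin n)

  -- P ∈ Π(u): an equivalence relation on V \ {u} coarsening comps(T - u)
  InΠ : Fin n → (Fin n → Fin n → Bool) → Set
  InΠ u P = (∀ x → T (notU u x) → T (P x x))
          × (∀ x y → T (notU u x) → T (notU u y) → T (P x y) → T (P y x))
          × (∀ x y z → T (notU u x) → T (notU u y) → T (notU u z) → T (P x y) → T (P y z) → T (P x z))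
          × (∀ x y → T (conn tr (notU u) x y) → T (P x y))

  -- y(P) for P ∈ Π(u) (zero unless P is assigned a weight)
  y : Fin n → (Fin n → Fin n → Bool) → ℚ
  y u P = sumℚ (map (λ e → if (proj₁ e == u) ∧ samePart u P (proj₁ (proj₂ e)) then proj₂ (proj₂ e) else 0ℚ) entries)

  -- Σ_{u ∈ nonleaf T} Σ_{P ∈ Π(u), j crosses P} y(P)
  -- (sum over the support of y; all other terms are 0)
  dualLoad : Fin m → ℚ
  dualLoad j = sumℚ (map (λ e → if crosses (proj₁ (proj₂ e)) (proj₁ e) j then proj₂ (proj₂ e) else 0ℚ) entries)

IsMaxTreePathLength : (I : Instance) → ℕ → Set
IsMaxTreePathLength I λ' =
    (∀ (j : Fin m) (xs : List (Fin n)) → IsPath tr (proj₁ (link j)) (proj₂ (link j)) xs → length xs ∸ 1 ≤ λ')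
  × Σ (Fin m) (λ j → Σ (List (Fin n)) (λ xs → IsPath tr (proj₁ (link j)) (proj₂ (link j)) xs × length xs ∸ 1 ≡ λ'))
  where open Instance I

{-# OPTIONS --safe #-}
module Submission where

-- The greedy ratios cost(ℓ*) / |inc^i(ℓ*)| never decrease: adding links only merges parts,
-- so |inc^i(ℓ)| shrinks for every link ℓ, and every pick minimises the ratio. Hence the
-- weights given to successive partitions of Π(u) increase, and y ≥ 0.
-- For the load of a fixed link ℓ, consider the potential: the sum, over the nodes u whose
-- current partition P^i_u is crossed by ℓ, of the latest weight given to a partition of Π(u).
-- Each such weight is at most cost(ℓ) / |inc^i(ℓ)|, since ℓ was a candidate when it was
-- assigned. The y-entries counted for ℓ telescope into the potential, and when ℓ stops
-- crossing d of the k partitions it crosses, the potential loses at most d · cost(ℓ) / k.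
-- Summing, the load of ℓ is at most cost(ℓ) · H(|inc^1(ℓ)|). Finally every u with ℓ crossing
-- P^1_u separates the ends of ℓ in T, so it is an inner node of the tree path T(ℓ), and
-- |inc^1(ℓ)| ≤ λ − 1.

open import Defs
open import Data.Nat using (ℕ; _∸_)
open import Data.Fin using (Fin)
open import Data.Bool using (Bool)
open import Data.List using (List)
open import Data.Product using (_×_)
open import Data.Rational using (0ℚ; _*_) renaming (_≤_ to _≤ℚ_)

open import Algebra.Bundles using (CommutativeMonoid; Ring)
open import Data.Bool using (true; false; _∧_; _∨_; not; if_then_else_; T)
open import Data.Bool.ListAction using (any)
open import Data.Bool.Properties using (T-∧; T-∨; if-eta)
open import Data.Empty using (⊥-elim)
open import Data.Fin as Fin using (_≟_; toℕ)
open import Data.Integer as ℤ using (+≤+)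
open import Data.List using ([]; _∷_; [_]; _++_; map; length; allFin; filterᵇ; take; drop; lookup)
open import Data.List.Membership.Propositional using (_∈_; find; lose)
open import Data.List.Membership.Propositional.Properties using (∈-++⁺ˡ; ∈-++⁺ʳ; ∈-++⁻; ∈-map⁻; ∈-∃++; ∈-allFin)
import Data.List.Membership.DecPropositional as DecMembership
open import Data.List.Properties using (length-drop; map-++; map-cong; map-∘; length-++; filter-++; filter-accept; filter-reject; filter-some; filter-notAll)
open import Data.List.Relation.Binary.Subset.Propositional using (_⊆_)
open import Data.List.Relation.Binary.Subset.Propositional.Properties using (Any-resp-⊆; xs⊆xs++ys; ++⁺ʳ; map⁺)
open import Data.List.Relation.Unary.All as All using (All; []; _∷_)
open import Data.List.Relation.Unary.AllPairs using ([]; _∷_)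
open import Data.List.Relation.Unary.Any as Any using (Any; here; there)
open import Data.List.Relation.Unary.Any.Properties using (any⁺; any⁻)
open import Data.List.Relation.Unary.Unique.Propositional using (Unique)
open import Data.List.Relation.Unary.Unique.Propositional.Properties using (allFin⁺)
open import Data.Nat as ℕ using (zero; suc; _≤_; _≤′_; ≤′-refl; ≤′-step; z≤n; s≤s)
import Data.Nat.Properties as ℕₚ
open import Data.Nat.Coprimality using (1-coprimeTo)
open import Data.Nat.ListAction using (sum)
open import Data.Product using (_,_; proj₁; proj₂; ∃-syntax)
open import Data.Rational using (ℚ; _+_; _-_; -_; _/_; *≤*; nonNegative)
import Data.Rational.Properties as ℚₚ
open import Data.Sum using (inj₁; inj₂; [_,_]′)
open import Data.Unit using (tt)
open import Function using (_∘_)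
open import Function.Bundles using (Equivalence)
open import Relation.Binary.PropositionalEquality using (_≡_; refl; sym; trans; cong; cong₂; subst; subst₂; module ≡-Reasoning)
open import Relation.Nullary using (¬_; yes; no)
open import Relation.Nullary.Decidable using (T?; toWitness; fromWitness)
open import Relation.Unary using () renaming (_⊆_ to _⊆ᵤ_)

open import Algebra.Properties.CommutativeSemigroup (CommutativeMonoid.commutativeSemigroup ℚₚ.+-0-commutativeMonoid) using (interchange; xy∙z≈y∙xz)
open import Algebra.Properties.Semiring.Mult (Ring.semiring ℚₚ.+-*-ring) using (×-comm-*) renaming (_×_ to _·_)

open Equivalence using (to; from)

T-not⁺ : ∀ {b} → ¬ T b → T (not b)
T-not⁺ {true}  ¬b = ¬b tt
T-not⁺ {false} _  = tt

T-not⁻ : ∀ {b} → T (not b) → ¬ T b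
T-not⁻ {true}  ()
T-not⁻ {false} _ ()

T-true : ∀ {b} → b ≡ true → T b
T-true refl = tt

==⇒≡ : ∀ {n} {x y : Fin n} → T (x == y) → x ≡ y
==⇒≡ = toWitness

==-refl : ∀ {n} {x : Fin n} → T (x == x)
==-refl = fromWitness refl

indicator-sum≡length-filterᵇ : ∀ {A : Set} (p : A → Bool) xs →
  sum (map (λ x → if p x then 1 else 0) xs) ≡ length (filterᵇ p xs)
indicator-sum≡length-filterᵇ p [] = refl
indicator-sum≡length-filterᵇ p (x ∷ xs) with p x
... | true  = cong suc (indicator-sum≡length-filterᵇ p xs)
... | false = indicator-sum≡length-filterᵇ p xs

length-filterᵇ-split : ∀ {A : Set} (p q : A → Bool) → (∀ {x} → T (q x) → T (p x)) → ∀ xs →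
  length (filterᵇ p xs) ≡ length (filterᵇ q xs) ℕ.+ length (filterᵇ (λ x → p x ∧ not (q x)) xs)
length-filterᵇ-split p q q⇒p [] = refl
length-filterᵇ-split p q q⇒p (x ∷ xs) with ih ← length-filterᵇ-split p q q⇒p xs | q x in qx | p x in px
... | true  | true  = cong suc ih
... | true  | false = ⊥-elim (subst T px (q⇒p (T-true qx)))
... | false | true  = trans (cong suc ih) (sym (ℕₚ.+-suc _ _))
... | false | false = ih

length-filterᵇ-unique-≤ : ∀ {A : Set} (p : A → Bool) {ys xs : List A} → Unique ys →
  (∀ {y} → y ∈ ys → T (p y) → y ∈ xs) → length (filterᵇ p ys) ≤ length (filterᵇ p xs)
length-filterᵇ-unique-≤ p {[]} _ _ = z≤n
length-filterᵇ-unique-≤ p {y ∷ ys} (y∉ys ∷ uniq) ys⊆xs with p y in py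
... | false = length-filterᵇ-unique-≤ p uniq (ys⊆xs ∘ there)
... | true with as , bs , refl ← ∈-∃++ (ys⊆xs (here refl) (T-true py)) = begin
    suc (length (filterᵇ p ys))              ≤⟨ s≤s (length-filterᵇ-unique-≤ p uniq ys⊆as++bs) ⟩
    suc (length (filterᵇ p (as ++ bs)))      ≡⟨ cong suc (length-filterᵇ-++ as bs) ⟩
    suc (length (filterᵇ p as) ℕ.+ length (filterᵇ p bs))
                                             ≡⟨ sym (ℕₚ.+-suc _ _) ⟩
    length (filterᵇ p as) ℕ.+ length (y ∷ filterᵇ p bs)
                                             ≡⟨ cong (λ zs → length (filterᵇ p as) ℕ.+ length zs)
                                                     (sym (filter-accept (T? ∘ p) (T-true py))) ⟩
    length (filterᵇ p as) ℕ.+ length (filterᵇ p (y ∷ bs))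
                                             ≡⟨ sym (length-filterᵇ-++ as (y ∷ bs)) ⟩
    length (filterᵇ p (as ++ [ y ] ++ bs))   ∎
  where
  open ℕₚ.≤-Reasoning
  length-filterᵇ-++ : ∀ us vs → length (filterᵇ p (us ++ vs)) ≡ length (filterᵇ p us) ℕ.+ length (filterᵇ p vs)
  length-filterᵇ-++ us vs = trans (cong length (filter-++ (T? ∘ p) us vs)) (length-++ (filterᵇ p us))
  ys⊆as++bs : ∀ {z} → z ∈ ys → T (p z) → z ∈ as ++ bs
  ys⊆as++bs {z} z∈ys pz with ∈-++⁻ as (ys⊆xs (there z∈ys) pz)
  ... | inj₁ z∈as         = ∈-++⁺ˡ z∈as
  ... | inj₂ (here z≡y)   = ⊥-elim (All.lookup y∉ys z∈ys (sym z≡y))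
  ... | inj₂ (there z∈bs) = ∈-++⁺ʳ as z∈bs

count-split : ∀ {n} (p q : Fin n → Bool) → (∀ {u} → T (q u) → T (p u)) →
  count p ≡ count q ℕ.+ count (λ u → p u ∧ not (q u))
count-split {n} p q q⇒p = begin
  count p                       ≡⟨ indicator-sum≡length-filterᵇ p (allFin n) ⟩
  length (filterᵇ p (allFin n)) ≡⟨ length-filterᵇ-split p q q⇒p (allFin n) ⟩
  length (filterᵇ q (allFin n)) ℕ.+ length (filterᵇ p∖q (allFin n))
                                ≡⟨ cong₂ ℕ._+_ (indicator-sum≡length-filterᵇ q (allFin n))
                                               (indicator-sum≡length-filterᵇ p∖q (allFin n)) ⟨
  count q ℕ.+ count p∖q         ∎
  where
  open ≡-Reasoning
  p∖q : Fin _ → Bool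
  p∖q u = p u ∧ not (q u)

count-mono : ∀ {n} {p q : Fin n → Bool} → (∀ {u} → T (q u) → T (p u)) → count q ≤ count p
count-mono {p = p} {q} q⇒p = subst (_ ≤_) (sym (count-split p q q⇒p)) (ℕₚ.m≤m+n _ _)

count-pos : ∀ {n} (p : Fin n → Bool) {u} → T (p u) → 1 ≤ count p
count-pos {n} p {u} pu = subst (1 ≤_) (sym (indicator-sum≡length-filterᵇ p (allFin n)))
  (filter-some (T? ∘ p) (lose (∈-allFin u) pu))

sumℚ-++ : ∀ xs ys → sumℚ (xs ++ ys) ≡ sumℚ xs + sumℚ ys
sumℚ-++ []       ys = sym (ℚₚ.+-identityˡ (sumℚ ys))
sumℚ-++ (x ∷ xs) ys = trans (cong (x +_) (sumℚ-++ xs ys)) (sym (ℚₚ.+-assoc x (sumℚ xs) (sumℚ ys)))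

sumℚ-map-+ : ∀ {A : Set} (f g : A → ℚ) xs →
  sumℚ (map (λ x → f x + g x) xs) ≡ sumℚ (map f xs) + sumℚ (map g xs)
sumℚ-map-+ f g []       = refl
sumℚ-map-+ f g (x ∷ xs) =
  trans (cong (f x + g x +_) (sumℚ-map-+ f g xs)) (interchange (f x) (g x) (sumℚ (map f xs)) (sumℚ (map g xs)))

sumℚ-map-mono : ∀ {A : Set} {f g : A → ℚ} → (∀ x → f x ≤ℚ g x) → ∀ xs →
  sumℚ (map f xs) ≤ℚ sumℚ (map g xs)
sumℚ-map-mono f≤g []       = ℚₚ.≤-refl
sumℚ-map-mono f≤g (x ∷ xs) = ℚₚ.+-mono-≤ (f≤g x) (sumℚ-map-mono f≤g xs)

sumℚ-map-nonneg : ∀ {A : Set} (f : A → ℚ) xs → (∀ {x} → x ∈ xs → 0ℚ ≤ℚ f x) → 0ℚ ≤ℚ sumℚ (map f xs)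
sumℚ-map-nonneg f []       _  = ℚₚ.≤-refl
sumℚ-map-nonneg f (x ∷ xs) f≥0 = ℚₚ.+-mono-≤ (f≥0 (here refl)) (sumℚ-map-nonneg f xs (f≥0 ∘ there))

sumℚ-map-zero : ∀ {A : Set} (f : A → ℚ) → (∀ x → f x ≡ 0ℚ) → ∀ xs → sumℚ (map f xs) ≡ 0ℚ
sumℚ-map-zero f f≡0 []       = refl
sumℚ-map-zero f f≡0 (x ∷ xs) = cong₂ _+_ (f≡0 x) (sumℚ-map-zero f f≡0 xs)

sumℚ-map-filterᵇ : ∀ {A : Set} (f : A → ℚ) (p : A → Bool) xs →
  sumℚ (map f (filterᵇ p xs)) ≡ sumℚ (map (λ x → if p x then f x else 0ℚ) xs)
sumℚ-map-filterᵇ f p [] = refl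
sumℚ-map-filterᵇ f p (x ∷ xs) with p x
... | true  = cong (f x +_) (sumℚ-map-filterᵇ f p xs)
... | false = trans (sumℚ-map-filterᵇ f p xs) (sym (ℚₚ.+-identityˡ _))

sumℚ-indicator : ∀ {A : Set} (p : A → Bool) r xs →
  sumℚ (map (λ x → if p x then r else 0ℚ) xs) ≡ sum (map (λ x → if p x then 1 else 0) xs) · r
sumℚ-indicator p r [] = refl
sumℚ-indicator p r (x ∷ xs) with p x
... | true  = cong (r +_) (sumℚ-indicator p r xs)
... | false = trans (ℚₚ.+-identityˡ _) (sumℚ-indicator p r xs)

if-false : ∀ {b} x → ¬ T b → (if b then x else 0ℚ) ≡ 0ℚ
if-false {true}  x ¬b = ⊥-elim (¬b tt)
if-false {false} x _  = refl

if-≤ : ∀ b {x y z : ℚ} → x ≤ℚ z → y ≤ℚ z → (if b then x else y) ≤ℚ z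
if-≤ true  x≤z _   = x≤z
if-≤ false _   y≤z = y≤z

if-mono : ∀ b {x y} → (T b → x ≤ℚ y) → (if b then x else 0ℚ) ≤ℚ (if b then y else 0ℚ)
if-mono true  x≤y = x≤y tt
if-mono false _   = ℚₚ.≤-refl

if-nonneg : ∀ b {x} → 0ℚ ≤ℚ x → 0ℚ ≤ℚ (if b then x else 0ℚ)
if-nonneg true  x≥0 = x≥0
if-nonneg false _   = ℚₚ.≤-refl

p≤q⇒0≤q-p : ∀ {p q} → p ≤ℚ q → 0ℚ ≤ℚ q - p
p≤q⇒0≤q-p {p} {q} p≤q = begin
  0ℚ      ≡⟨ sym (ℚₚ.+-inverseʳ p) ⟩
  p - p   ≤⟨ ℚₚ.+-monoˡ-≤ (- p) p≤q ⟩
  q - p   ∎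
  where open ℚₚ.≤-Reasoning

p-q+q≡p : ∀ p q → (p - q) + q ≡ p
p-q+q≡p p q = begin
  (p - q) + q    ≡⟨ ℚₚ.+-assoc p (- q) q ⟩
  p + (- q + q)  ≡⟨ cong (p +_) (ℚₚ.+-inverseˡ q) ⟩
  p + 0ℚ         ≡⟨ ℚₚ.+-identityʳ p ⟩
  p              ∎
  where open ≡-Reasoning

-- For one node: the new dual entry a − b (counted if the link crosses) plus the old weight
-- b is the new weight a, which stays in the potential or is dropped as the link keeps
-- crossing or not.
exchange-pointwise : ∀ (nl cℓ cℓ′ cj : Bool) (a b : ℚ) → (T cℓ′ → T cℓ) →
    (if nl ∧ cj then (if cℓ then a - b else 0ℚ) else 0ℚ) + (if nl ∧ cℓ then b else 0ℚ)
  ≡ (if nl ∧ cℓ′ then (if nl ∧ cj then a else b) else 0ℚ)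
    + (if (nl ∧ cℓ) ∧ not (nl ∧ cℓ′) then (if nl ∧ cj then a else b) else 0ℚ)
exchange-pointwise false _     _     _     a b _ = refl
exchange-pointwise true  false true  _     a b h = ⊥-elim (h tt)
exchange-pointwise true  false false true  a b _ = refl
exchange-pointwise true  false false false a b _ = refl
exchange-pointwise true  true  true  true  a b _ = trans (p-q+q≡p a b) (sym (ℚₚ.+-identityʳ a))
exchange-pointwise true  true  true  false a b _ = trans (ℚₚ.+-identityˡ b) (sym (ℚₚ.+-identityʳ b))
exchange-pointwise true  true  false true  a b _ = trans (p-q+q≡p a b) (sym (ℚₚ.+-identityˡ a))
exchange-pointwise true  true  false false a b _ = refl

*-nonneg : ∀ {p q} → 0ℚ ≤ℚ p → 0ℚ ≤ℚ q → 0ℚ ≤ℚ p * q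
*-nonneg {p} {q} p≥0 q≥0 = ℚₚ.nonNegative⁻¹ _ {{ℚₚ.nonNeg*nonNeg⇒nonNeg p {{nonNegative p≥0}} q {{nonNegative q≥0}}}}

*-monoˡ-≤-nonneg : ∀ {c p q} → 0ℚ ≤ℚ c → p ≤ℚ q → c * p ≤ℚ c * q
*-monoˡ-≤-nonneg {c} c≥0 = ℚₚ.*-monoˡ-≤-nonNeg c {{nonNegative c≥0}}

inv-suc : ℕ → ℚ
inv-suc k = ℤ.+ 1 / suc k

inv-suc-nonneg : ∀ k → 0ℚ ≤ℚ inv-suc k
inv-suc-nonneg k = ℚₚ.nonNegative⁻¹ _ {{ℚₚ.normalize-nonNeg 1 (suc k)}}

inv-suc-antimono-≤ : ∀ {m n} → m ≤ n → inv-suc n ≤ℚ inv-suc m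
inv-suc-antimono-≤ {m} {n} m≤n
  rewrite ℚₚ.normalize-coprime {1} {m} (1-coprimeTo (suc m))
        | ℚₚ.normalize-coprime {1} {n} (1-coprimeTo (suc n))
  = *≤* (+≤+ (ℕₚ.*-monoʳ-≤ 1 (s≤s m≤n)))

-- ratio c k unfolds to c * inv-suc (k ∸ 1): it is c / k for k ≥ 1, and c for k = 0.
ratio-nonneg : ∀ {c} k → 0ℚ ≤ℚ c → 0ℚ ≤ℚ ratio c k
ratio-nonneg k c≥0 = *-nonneg c≥0 (inv-suc-nonneg (k ∸ 1))

ratio-antimono-≤ : ∀ {c m n} → 0ℚ ≤ℚ c → m ≤ n → ratio c n ≤ℚ ratio c m
ratio-antimono-≤ c≥0 m≤n = *-monoˡ-≤-nonneg c≥0 (inv-suc-antimono-≤ (ℕₚ.∸-monoˡ-≤ 1 m≤n))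

harmonic-mono-≤ : ∀ {m n} → m ≤ n → harmonic m ≤ℚ harmonic n
harmonic-mono-≤ {m} {zero}  z≤n = ℚₚ.≤-refl
harmonic-mono-≤ {m} {suc n} m≤1+n with ℕₚ.m≤n⇒m<n∨m≡n m≤1+n
... | inj₂ refl      = ℚₚ.≤-refl
... | inj₁ (s≤s m≤n) = begin
  harmonic m                     ≤⟨ harmonic-mono-≤ m≤n ⟩
  harmonic n                     ≡⟨ sym (ℚₚ.+-identityʳ _) ⟩
  harmonic n + 0ℚ                ≤⟨ ℚₚ.+-monoʳ-≤ (harmonic n) (inv-suc-nonneg n) ⟩
  harmonic (suc n)               ∎
  where open ℚₚ.≤-Reasoning

harmonic-nonneg : ∀ k → 0ℚ ≤ℚ harmonic k
harmonic-nonneg k = harmonic-mono-≤ {0} {k} z≤n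

-- Each of the d terms 1/(a+1), …, 1/k of H(k) − H(a) is at least 1/k.
harmonic-gap : ∀ a d k → a ℕ.+ d ≡ k → harmonic a + d · inv-suc (k ∸ 1) ≤ℚ harmonic k
harmonic-gap a zero k refl = ℚₚ.≤-reflexive (trans (ℚₚ.+-identityʳ _) (cong harmonic (sym (ℕₚ.+-identityʳ a))))
harmonic-gap a (suc d) k a+1+d≡k = begin
  harmonic a + (x + d · x)       ≡⟨ sym (ℚₚ.+-assoc (harmonic a) x (d · x)) ⟩
  (harmonic a + x) + d · x       ≤⟨ ℚₚ.+-monoˡ-≤ (d · x) (ℚₚ.+-monoʳ-≤ (harmonic a) (inv-suc-antimono-≤ a≤k-1)) ⟩
  harmonic (suc a) + d · x       ≤⟨ harmonic-gap (suc a) d k (trans (sym (ℕₚ.+-suc a d)) a+1+d≡k) ⟩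
  harmonic k                     ∎
  where
  open ℚₚ.≤-Reasoning
  x = inv-suc (k ∸ 1)
  a≤k-1 : a ≤ k ∸ 1
  a≤k-1 = subst (λ t → a ≤ t ∸ 1) (trans (sym (ℕₚ.+-suc a d)) a+1+d≡k) (ℕₚ.m≤m+n a d)

Separates : ∀ {n} → EdgeList n → Fin n → Fin n → Fin n → Set
Separates E u a b = T (notU u a) × T (notU u b) × ¬ T (conn E (notU u) a b)

-- step E ok S v unfolds to S v ∨ (ok v ∧ any (joins S v) E), and conn E ok x to
-- iter n (step E ok) (source ok x).
source : ∀ {n} → (Fin n → Bool) → Fin n → Fin n → Bool
source ok x v = ok x ∧ (v == x)

joins : ∀ {n} → (Fin n → Bool) → Fin n → Edge n → Bool
joins S v e = ((proj₁ e == v) ∧ S (proj₂ e)) ∨ ((proj₂ e == v) ∧ S (proj₁ e))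

SameEdge-swap : ∀ {n} {e : Edge n} {x z} → SameEdge e (x , z) → SameEdge e (z , x)
SameEdge-swap (inj₁ (e₁≡x , e₂≡z)) = inj₂ (e₁≡x , e₂≡z)
SameEdge-swap (inj₂ (e₁≡z , e₂≡x)) = inj₁ (e₁≡z , e₂≡x)

adjacent⇒joins : ∀ {n} {S : Fin n → Bool} {a b v z} → SameEdge (a , b) (v , z) → T (S z) → T (joins S v (a , b))
adjacent⇒joins {S = S} {v = v} {z} (inj₁ (refl , refl)) sz = from (T-∨ {(v == v) ∧ S z}) (inj₁ (from T-∧ (==-refl , sz)))
adjacent⇒joins {S = S} {v = v} {z} (inj₂ (refl , refl)) sz = from (T-∨ {(z == v) ∧ S v}) (inj₂ (from T-∧ (==-refl , sz)))

joins⇒adjacent : ∀ {n} {S : Fin n → Bool} {v} e → T (joins S v e) → ∃[ z ] (SameEdge e (v , z) × T (S z))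
joins⇒adjacent {S = S} {v} (a , b) j with to (T-∨ {(a == v) ∧ S b}) j
... | inj₁ a=v∧sb = let a=v , sb = to T-∧ a=v∧sb in b , inj₁ (==⇒≡ a=v , refl) , sb
... | inj₂ b=v∧sa = let b=v , sa = to T-∧ b=v∧sa in a , inj₂ (refl , ==⇒≡ b=v) , sa

step-inflationary : ∀ {n} (E : EdgeList n) ok S → (T ∘ S) ⊆ᵤ (T ∘ step E ok S)
step-inflationary E ok S {v} = from (T-∨ {S v}) ∘ inj₁

step-adjacent : ∀ {n} {E : EdgeList n} {ok S x z} → Adj E x z → T (S x) → T (ok z) → T (step E ok S z)
step-adjacent {ok = ok} {S} {z = z} adj sx okz with e , e∈E , same ← find adj =
  from (T-∨ {S z}) (inj₂ (from (T-∧ {ok z}) (okz , any⁺ (joins S z) (lose e∈E (adjacent⇒joins (SameEdge-swap same) sx)))))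

step-new : ∀ {n} {E : EdgeList n} {ok S v} → ¬ T (S v) → T (step E ok S v) → T (ok v) × ∃[ z ] (Adj E v z × T (S z))
step-new {E = E} {ok} {S} {v} ¬sv sv′ with to (T-∨ {S v}) sv′
... | inj₁ sv = ⊥-elim (¬sv sv)
... | inj₂ new with okv , j ← to (T-∧ {ok v}) new
                with e , e∈E , je ← find (any⁻ (joins S v) E j)
                with z , same , sz ← joins⇒adjacent e je = okv , z , lose e∈E same , sz

Adj-sym : ∀ {n} {E : EdgeList n} {x z} → Adj E x z → Adj E z x
Adj-sym = Any.map SameEdge-swap

step-mono : ∀ {n} {E E′ : EdgeList n} {ok S S′} → E ⊆ E′ → (T ∘ S) ⊆ᵤ (T ∘ S′) →
  (T ∘ step E ok S) ⊆ᵤ (T ∘ step E′ ok S′)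
step-mono {E = E} {E′} {ok} {S} {S′} E⊆E′ S⊆S′ {v} sv with T? (S v)
... | yes s  = step-inflationary E′ ok S′ (S⊆S′ s)
... | no ¬s with okv , z , adj , sz ← step-new {E = E} {ok} {S} ¬s sv =
  step-adjacent {ok = ok} {S′} (Adj-sym (Any-resp-⊆ E⊆E′ adj)) (S⊆S′ sz) okv

iter-step-mono : ∀ {n} {E E′ : EdgeList n} {ok S} → E ⊆ E′ → ∀ k →
  (T ∘ iter k (step E ok) S) ⊆ᵤ (T ∘ iter k (step E′ ok) S)
iter-step-mono E⊆E′ zero    s = s
iter-step-mono {E = E} {E′} {ok} {S} E⊆E′ (suc k) =
  step-mono {ok = ok} {iter k (step E ok) S} {iter k (step E′ ok) S} E⊆E′ (iter-step-mono E⊆E′ k)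

iter-step-≤ : ∀ {n} {E : EdgeList n} {ok S k k′} → k ≤′ k′ →
  (T ∘ iter k (step E ok) S) ⊆ᵤ (T ∘ iter k′ (step E ok) S)
iter-step-≤ ≤′-refl s = s
iter-step-≤ {E = E} {ok} {S} {k′ = suc k′} (≤′-step k≤k′) s =
  step-inflationary E ok (iter k′ (step E ok) S) (iter-step-≤ {E = E} {ok} {S} k≤k′ s)

iter-shift : ∀ {A : Set} (f : A → A) k a → iter k f (f a) ≡ f (iter k f a)
iter-shift f zero    a = refl
iter-shift f (suc k) a = cong f (iter-shift f k a)

conn-mono : ∀ {n} {E E′ : EdgeList n} {ok} → E ⊆ E′ → ∀ x y → T (conn E ok x y) → T (conn E′ ok x y)
conn-mono {n} {ok = ok} E⊆E′ x y = iter-step-mono {ok = ok} E⊆E′ n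

Separates-antimono : ∀ {n} {E E′ : EdgeList n} {u a b} → E ⊆ E′ → Separates E′ u a b → Separates E u a b
Separates-antimono {a = a} {b} E⊆E′ (ua , ub , ¬conn) = ua , ub , ¬conn ∘ conn-mono E⊆E′ a b

walk-head : ∀ {n} {E : EdgeList n} {x y xs} → Walk E x y xs → x ∈ xs
walk-head (single _) = here refl
walk-head (cons _ _) = here refl

walk-last : ∀ {n} {E : EdgeList n} {x y xs} → Walk E x y xs → y ∈ xs
walk-last (single _) = here refl
walk-last (cons _ w) = there (walk-last w)

walk-length : ∀ {n} {E : EdgeList n} {x y xs} → Walk E x y xs → length xs ≡ suc (length xs ∸ 1)
walk-length (single _) = refl
walk-length (cons _ _) = refl

walk⇒reach : ∀ {n} {E : EdgeList n} {ok x y xs} → Walk E x y xs → All (T ∘ ok) xs →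
  ∀ S → T (S x) → T (iter (length xs ∸ 1) (step E ok) S y)
walk⇒reach (single x) _ S sx = sx
walk⇒reach {E = E} {ok} {y = y} (cons {xs = xs} adj w) (_ ∷ ok-xs) S sx =
  subst (λ k → T (iter k (step E ok) S y)) (sym (walk-length w))
    (subst (λ R → T (R y)) (iter-shift (step E ok) (length xs ∸ 1) S)
      (walk⇒reach w ok-xs (step E ok S) (step-adjacent {ok = ok} {S} adj sx (All.lookup ok-xs (walk-head w)))))

record PathInside {n} (E : EdgeList n) (R : Fin n → Bool) (k : ℕ) (v b : Fin n) : Set where
  field
    nodes  : List (Fin n)
    walk   : Walk E v b nodes
    unique : Unique nodes
    inside : All (T ∘ R) nodes
    short  : length nodes ≤ suc k

reach⇒path : ∀ {n} (E : EdgeList n) ok b k {v} → T (iter k (step E ok) (source ok b) v) →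
  PathInside E (iter k (step E ok) (source ok b)) k v b
reach⇒path E ok b zero {v} sv with refl ← ==⇒≡ {x = v} {b} (proj₂ (to T-∧ sv)) = record
  { nodes = v ∷ [] ; walk = single v ; unique = [] ∷ [] ; inside = sv ∷ [] ; short = s≤s z≤n }
reach⇒path E ok b (suc k) {v} sv with T? (iter k (step E ok) (source ok b) v)
... | yes rv = record
  { nodes  = nodes
  ; walk   = walk
  ; unique = unique
  ; inside = All.map (step-inflationary E ok _) inside
  ; short  = ℕₚ.m≤n⇒m≤1+n short
  }
  where open PathInside (reach⇒path E ok b k rv)
... | no ¬rv with _ , z , adj , rz ← step-new {E = E} {ok} {iter k (step E ok) (source ok b)} ¬rv sv = record
  { nodes  = v ∷ nodes
  ; walk   = cons adj walk
  ; unique = All.map (λ rw v≡w → ¬rv (subst (T ∘ iter k (step E ok) (source ok b)) (sym v≡w) rw)) inside ∷ unique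
  ; inside = sv ∷ All.map (step-inflationary E ok _) inside
  ; short  = s≤s short
  }
  where open PathInside (reach⇒path E ok b k rz)

-- The length bound is needed because conn only runs n rounds of step.
separator∈walk : ∀ {n} {E : EdgeList n} {u a b xs} → Walk E a b xs → length xs ≤ suc n → Separates E u a b → u ∈ xs
separator∈walk {n} {E} {u} {a} {b} {xs} w short (ua , _ , ¬conn) with u ∈? xs
  where open DecMembership (_≟_ {n}) using (_∈?_)
... | yes u∈xs = u∈xs
... | no  u∉xs = ⊥-elim (¬conn (iter-step-≤ {E = E} {notU u} {source (notU u) a} (ℕₚ.≤⇒≤′ (ℕₚ.∸-monoˡ-≤ 1 short))
                   (walk⇒reach {ok = notU u} w avoids-u (source (notU u) a) (from T-∧ (ua , ==-refl)))))
  where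
  avoids-u : All (T ∘ notU u) xs
  avoids-u = All.tabulate (λ w∈xs → T-not⁺ (λ w=u → u∉xs (subst (_∈ xs) (==⇒≡ w=u) w∈xs)))

length-filterᵇ-walk : ∀ {n} {E : EdgeList n} (p : Fin n → Bool) {a b xs} → Walk E a b xs →
  ¬ T (p a) → ¬ T (p b) → length (filterᵇ p xs) ≤ length xs ∸ 2
length-filterᵇ-walk p (single a) ¬pa _ = ℕₚ.≤-reflexive (cong length (filter-reject (T? ∘ p) ¬pa))
length-filterᵇ-walk p (cons {xs = xs} _ w) ¬pa ¬pb = begin
  length (filterᵇ p (_ ∷ xs))  ≡⟨ cong length (filter-reject (T? ∘ p) ¬pa) ⟩
  length (filterᵇ p xs)        ≤⟨ ℕₚ.∸-monoˡ-≤ 1 (filter-notAll (T? ∘ p) xs (lose (walk-last w) ¬pb)) ⟩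
  length xs ∸ 1                ∎
  where open ℕₚ.≤-Reasoning

separators-count-≤ : ∀ {n} {E : EdgeList n} (p : Fin n → Bool) {a b λ'} → Connected E allNodes →
  (∀ xs → IsPath E a b xs → length xs ∸ 1 ≤ λ') → (∀ {u} → T (p u) → Separates E u a b) → count p ≤ λ' ∸ 1
separators-count-≤ {n} {E} p {a} {b} {λ'} connected paths-≤ separates = begin
  count p                        ≡⟨ indicator-sum≡length-filterᵇ p (allFin n) ⟩
  length (filterᵇ p (allFin n))  ≤⟨ length-filterᵇ-unique-≤ p (allFin⁺ n)
                                       (λ _ pu → separator∈walk walk short (separates pu)) ⟩
  length (filterᵇ p nodes)       ≤⟨ length-filterᵇ-walk p walk
                                       (not-self-separating proj₁) (not-self-separating (proj₁ ∘ proj₂)) ⟩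
  length nodes ∸ 2               ≡⟨ ℕₚ.∸-+-assoc (length nodes) 1 1 ⟨
  length nodes ∸ 1 ∸ 1           ≤⟨ ℕₚ.∸-monoˡ-≤ 1 (paths-≤ nodes (walk , unique)) ⟩
  λ' ∸ 1                         ∎
  where
  open ℕₚ.≤-Reasoning
  open PathInside (reach⇒path E allNodes b n (connected b a tt tt))
  not-self-separating : ∀ {x} → (Separates E x a b → T (notU x x)) → ¬ T (p x)
  not-self-separating endpoint px = T-not⁻ (endpoint (separates px)) ==-refl

take-⊆ : ∀ {A : Set} {i i′} (xs : List A) → i ≤ i′ → take i xs ⊆ take i′ xs
take-⊆ {i = suc i} {suc i′} (x ∷ xs) (s≤s i≤i′) (here y≡x)  = here y≡x
take-⊆ {i = suc i} {suc i′} (x ∷ xs) (s≤s i≤i′) (there y∈) = there (take-⊆ xs i≤i′ y∈)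

drop-∷ : ∀ {A : Set} i (xs : List A) {j r} → drop i xs ≡ j ∷ r → drop (suc i) xs ≡ r
drop-∷ zero    (x ∷ xs) refl = refl
drop-∷ (suc i) (x ∷ xs) eq   = drop-∷ i xs eq

drop-∷⇒lookup : ∀ {A : Set} i (xs : List A) {j r} → drop i xs ≡ j ∷ r →
  ∃[ k ] (toℕ k ≡ i × lookup xs k ≡ j)
drop-∷⇒lookup zero    (x ∷ xs) refl = Fin.zero , refl , refl
drop-∷⇒lookup (suc i) (x ∷ xs) eq with k , refl , xs[k]≡j ← drop-∷⇒lookup i xs eq = Fin.suc k , refl , xs[k]≡j

drop-[]⇒length≤ : ∀ {A : Set} i (xs : List A) → drop i xs ≡ [] → length xs ≤ i
drop-[]⇒length≤ i xs eq = ℕₚ.m∸n≡0⇒m≤n (trans (sym (length-drop i xs)) (cong length eq))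

module GreedyRun {I : Instance} (isI : Is2NCTAP I) {ls : List (Fin (Instance.m I))}
                 (run : Greedy.IsGreedyRun I ls) where
  open Instance I
  open Is2NCTAP isI using (spanning; costNonneg)
  open Greedy I ls
  open IsGreedyRun run using (incPos; minimal; done)

  incident : ℕ → Fin m → Fin n → Bool
  incident i j u = nonleaf tr u ∧ crosses i u j

  ratioAt : ℕ → Fin m → ℚ
  ratioAt i j = ratio (cost j) (inc i j)

  -- The where-clauses of Greedy.go: the latest weight per node once iteration i picks j,
  -- and the dual entry (u , i , y(P^i_u)) recorded for it.
  reweight : ℕ → Fin m → (Fin n → ℚ) → Fin n → ℚ
  reweight i j w u = if incident i j u then ratioAt i j else w u

  entry : ℕ → Fin m → (Fin n → ℚ) → Fin n → Fin n × ℕ × ℚ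
  entry i j w u = u , i , ratioAt i j - w u

  F-mono : ∀ {i i′} → i ≤ i′ → tr ++ F i ⊆ tr ++ F i′
  F-mono i≤i′ = ++⁺ʳ tr (map⁺ link (take-⊆ ls i≤i′))

  crosses⇒separates : ∀ {i u j} → T (crosses i u j) → Separates (tr ++ F i) u (proj₁ (link j)) (proj₂ (link j))
  crosses⇒separates {i} {u} {j} c =
    let ua , rest = to (T-∧ {notU u (proj₁ (link j))}) c
        ub , ¬part = to (T-∧ {notU u (proj₂ (link j))}) rest
    in ua , ub , T-not⁻ ¬part

  separates⇒crosses : ∀ {i u j} → Separates (tr ++ F i) u (proj₁ (link j)) (proj₂ (link j)) → T (crosses i u j)
  separates⇒crosses (ua , ub , ¬conn) = from T-∧ (ua , from T-∧ (ub , T-not⁺ ¬conn))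

  crosses-antimono : ∀ {i i′ u j} → i ≤ i′ → T (crosses i′ u j) → T (crosses i u j)
  crosses-antimono i≤i′ = separates⇒crosses ∘ Separates-antimono (F-mono i≤i′) ∘ crosses⇒separates

  incident-antimono : ∀ {i i′ j u} → i ≤ i′ → T (incident i′ j u) → T (incident i j u)
  incident-antimono {u = u} i≤i′ x =
    let nl , c = to (T-∧ {nonleaf tr u}) x in from T-∧ (nl , crosses-antimono i≤i′ c)

  inc-antimono : ∀ {i i′} j → i ≤ i′ → inc i′ j ≤ inc i j
  inc-antimono {i} {i′} j i≤i′ = count-mono {p = incident i j} {incident i′ j} (incident-antimono i≤i′)

  no-crossing-after-run : ∀ {i u j} → length ls ≤ i → ¬ T (crosses i u j)
  no-crossing-after-run {u = u} ls≤i c with ua , ub , ¬conn ← Separates-antimono (F-mono ls≤i) (crosses⇒separates c) =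
    ¬conn (proj₂ (proj₂ done) u _ _ ua ub)

  picked-incident : ∀ {i j r} → drop i ls ≡ j ∷ r → 1 ≤ inc i j
  picked-incident {i} eq = let k , k≡i , ls[k]≡j = drop-∷⇒lookup i ls eq in
    subst₂ (λ i j → 1 ≤ inc i j) k≡i ls[k]≡j (incPos k)

  picked-minimal : ∀ {i j r} j′ → drop i ls ≡ j ∷ r → 1 ≤ inc i j′ → ratioAt i j ≤ℚ ratioAt i j′
  picked-minimal {i} j′ eq 1≤inc = let k , k≡i , ls[k]≡j = drop-∷⇒lookup i ls eq in
    subst₂ (λ i j → ratioAt i j ≤ℚ ratioAt i j′) k≡i ls[k]≡j
      (minimal k j′ (subst (λ i → 1 ≤ inc i j′) (sym k≡i) 1≤inc))

  -- A later pick j′ was already a candidate at iteration i, and its ratio has only grown since.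
  ratioAt-mono : ∀ {i i′ j j′ r r′} → i ≤ i′ → drop i ls ≡ j ∷ r → drop i′ ls ≡ j′ ∷ r′ →
    ratioAt i j ≤ℚ ratioAt i′ j′
  ratioAt-mono {i} {i′} {j} {j′} i≤i′ eq eq′ = begin
    ratioAt i j    ≤⟨ picked-minimal j′ eq (ℕₚ.≤-trans (picked-incident eq′) (inc-antimono j′ i≤i′)) ⟩
    ratioAt i j′   ≤⟨ ratio-antimono-≤ (costNonneg j′) (inc-antimono j′ i≤i′) ⟩
    ratioAt i′ j′  ∎
    where open ℚₚ.≤-Reasoning

  reweight-≤ : ∀ i j w u {z} → ratioAt i j ≤ℚ z → w u ≤ℚ z → reweight i j w u ≤ℚ z
  reweight-≤ i j w u = if-≤ (incident i j u)

  sumℚ-go-∷ : ∀ (f : Fin n × ℕ × ℚ → ℚ) i j r w →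
    sumℚ (map f (go i (j ∷ r) w))
      ≡ sumℚ (map (λ u → if incident i j u then f (entry i j w u) else 0ℚ) (allFin n))
        + sumℚ (map f (go (suc i) r (reweight i j w)))
  sumℚ-go-∷ f i j r w = begin
    sumℚ (map f (map (entry i j w) picked ++ rest))
      ≡⟨ cong sumℚ (map-++ f (map (entry i j w) picked) rest) ⟩
    sumℚ (map f (map (entry i j w) picked) ++ map f rest)
      ≡⟨ sumℚ-++ (map f (map (entry i j w) picked)) (map f rest) ⟩
    sumℚ (map f (map (entry i j w) picked)) + sumℚ (map f rest)
      ≡⟨ cong (λ s → sumℚ s + sumℚ (map f rest)) (sym (map-∘ picked)) ⟩
    sumℚ (map (f ∘ entry i j w) picked) + sumℚ (map f rest)
      ≡⟨ cong (_+ sumℚ (map f rest)) (sumℚ-map-filterᵇ (f ∘ entry i j w) (incident i j) (allFin n)) ⟩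
    sumℚ (map (λ u → if incident i j u then f (entry i j w u) else 0ℚ) (allFin n)) + sumℚ (map f rest)
      ∎
    where
    open ≡-Reasoning
    picked = filterᵇ (incident i j) (allFin n)
    rest = go (suc i) r (reweight i j w)

  WeightsBelow : ℕ → (Fin n → ℚ) → Set
  WeightsBelow i w = ∀ u {i′ j r} → i ≤ i′ → drop i′ ls ≡ j ∷ r → w u ≤ℚ ratioAt i′ j

  new-entries-nonneg : ∀ {i j r w} → drop i ls ≡ j ∷ r → WeightsBelow i w →
    ∀ {e} → e ∈ map (entry i j w) (filterᵇ (incident i j) (allFin n)) → 0ℚ ≤ℚ proj₂ (proj₂ e)
  new-entries-nonneg {i} {j} {w = w} eq below e∈ =
    let u , _ , e≡entry = ∈-map⁻ (entry i j w) e∈ in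
    subst (λ e → 0ℚ ≤ℚ proj₂ (proj₂ e)) (sym e≡entry) (p≤q⇒0≤q-p {w u} {ratioAt i j} (below u ℕₚ.≤-refl eq))

  go-values-nonneg : ∀ i r w → drop i ls ≡ r → WeightsBelow i w →
    ∀ {e} → e ∈ go i r w → 0ℚ ≤ℚ proj₂ (proj₂ e)
  go-values-nonneg i []      w _  _     ()
  go-values-nonneg i (j ∷ r) w eq below e∈ =
    [ new-entries-nonneg eq below , go-values-nonneg (suc i) r (reweight i j w) (drop-∷ i ls eq) below′ ]′
      (∈-++⁻ (map (entry i j w) (filterᵇ (incident i j) (allFin n))) e∈)
    where
    below′ : WeightsBelow (suc i) (reweight i j w)
    below′ u i<i′ eq′ = reweight-≤ i j w u (ratioAt-mono (ℕₚ.<⇒≤ i<i′) eq eq′) (below u (ℕₚ.<⇒≤ i<i′) eq′)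

  y-nonneg : ∀ u P → 0ℚ ≤ℚ y u P
  y-nonneg u P = sumℚ-map-nonneg _ entries
    (λ e∈ → if-nonneg _ (go-values-nonneg 0 ls (λ _ → 0ℚ) refl zero-below e∈))
    where
    zero-below : WeightsBelow 0 (λ _ → 0ℚ)
    zero-below _ {i′} {j} _ _ = ratio-nonneg (inc i′ j) (costNonneg j)

  module _ (ℓ : Fin m) where

    load-of : Fin n × ℕ × ℚ → ℚ
    load-of (u , i , v) = if crosses i u ℓ then v else 0ℚ

    load : List (Fin n × ℕ × ℚ) → ℚ
    load es = sumℚ (map load-of es)

    freshLoad : ℕ → Fin m → (Fin n → ℚ) → ℚ
    freshLoad i j w = sumℚ (map (λ u → if incident i j u then load-of (entry i j w u) else 0ℚ) (allFin n))

    potential : ℕ → (Fin n → ℚ) → ℚ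
    potential i w = sumℚ (map (λ u → if incident i ℓ u then w u else 0ℚ) (allFin n))

    leaves : ℕ → Fin n → Bool
    leaves i u = incident i ℓ u ∧ not (incident (suc i) ℓ u)

    dropped : ℕ → (Fin n → ℚ) → ℚ
    dropped i w = sumℚ (map (λ u → if leaves i u then w u else 0ℚ) (allFin n))

    Capped : ℕ → (Fin n → ℚ) → Set
    Capped i w = ∀ {u} → T (incident i ℓ u) → w u ≤ℚ ratioAt i ℓ

    reweight-capped : ∀ {i j r w} → drop i ls ≡ j ∷ r → Capped i w → Capped i (reweight i j w)
    reweight-capped {i} {j} {w = w} eq capped {u} ℓ∋u =
      reweight-≤ i j w u (picked-minimal ℓ eq (count-pos (incident i ℓ) ℓ∋u)) (capped ℓ∋u)

    Capped-suc : ∀ {i w} → Capped i w → Capped (suc i) w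
    Capped-suc {i} capped ℓ∋u = ℚₚ.≤-trans (capped (incident-antimono (ℕₚ.n≤1+n i) ℓ∋u))
      (ratio-antimono-≤ (costNonneg ℓ) (inc-antimono ℓ (ℕₚ.n≤1+n i)))

    potential-exchange : ∀ i j w →
      freshLoad i j w + potential i w ≡ potential (suc i) (reweight i j w) + dropped i (reweight i j w)
    potential-exchange i j w = begin
      sumℚ (map new (allFin n)) + sumℚ (map old (allFin n))
        ≡⟨ sumℚ-map-+ new old (allFin n) ⟨
      sumℚ (map (λ u → new u + old u) (allFin n))
        ≡⟨ cong sumℚ (map-cong (λ u → exchange-pointwise (nonleaf tr u) (crosses i u ℓ) (crosses (suc i) u ℓ)
                                        (crosses i u j) (ratioAt i j) (w u) (crosses-antimono (ℕₚ.n≤1+n i))) (allFin n)) ⟩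
      sumℚ (map (λ u → kept u + gone u) (allFin n))
        ≡⟨ sumℚ-map-+ kept gone (allFin n) ⟩
      potential (suc i) (reweight i j w) + dropped i (reweight i j w)
        ∎
      where
      open ≡-Reasoning
      new old kept gone : Fin n → ℚ
      new u  = if incident i j u then load-of (entry i j w u) else 0ℚ
      old u  = if incident i ℓ u then w u else 0ℚ
      kept u = if incident (suc i) ℓ u then reweight i j w u else 0ℚ
      gone u = if leaves i u then reweight i j w u else 0ℚ

    dropped-≤ : ∀ i w → Capped i w → dropped i w ≤ℚ cost ℓ * (count (leaves i) · inv-suc (inc i ℓ ∸ 1))
    dropped-≤ i w capped = begin
      dropped i w
        ≤⟨ sumℚ-map-mono (λ u → if-mono (leaves i u) (capped ∘ proj₁ ∘ to (T-∧ {incident i ℓ u}))) (allFin n) ⟩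
      sumℚ (map (λ u → if leaves i u then ratioAt i ℓ else 0ℚ) (allFin n))
        ≡⟨ sumℚ-indicator (leaves i) (ratioAt i ℓ) (allFin n) ⟩
      count (leaves i) · (cost ℓ * inv-suc (inc i ℓ ∸ 1))
        ≡⟨ ×-comm-* (count (leaves i)) (cost ℓ) (inv-suc (inc i ℓ ∸ 1)) ⟨
      cost ℓ * (count (leaves i) · inv-suc (inc i ℓ ∸ 1))
        ∎
      where open ℚₚ.≤-Reasoning

    load-potential-≤ : ∀ i r w → drop i ls ≡ r → Capped i w →
      load (go i r w) + potential i w ≤ℚ cost ℓ * harmonic (inc i ℓ)
    load-potential-≤ i [] w eq _ = begin
      0ℚ + potential i w  ≡⟨ ℚₚ.+-identityˡ _ ⟩
      potential i w       ≡⟨ sumℚ-map-zero _ (λ u → if-false {incident i ℓ u} (w u) (not-incident u)) (allFin n) ⟩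
      0ℚ                  ≤⟨ *-nonneg (costNonneg ℓ) (harmonic-nonneg (inc i ℓ)) ⟩
      cost ℓ * harmonic (inc i ℓ) ∎
      where
      open ℚₚ.≤-Reasoning
      not-incident : ∀ u → ¬ T (incident i ℓ u)
      not-incident u = no-crossing-after-run (drop-[]⇒length≤ i ls eq) ∘ proj₂ ∘ to (T-∧ {nonleaf tr u})
    load-potential-≤ i (j ∷ r) w eq capped = begin
      load (go i (j ∷ r) w) + potential i w
        ≡⟨ cong (_+ potential i w) (sumℚ-go-∷ load-of i j r w) ⟩
      (freshLoad i j w + load rest) + potential i w
        ≡⟨ xy∙z≈y∙xz (freshLoad i j w) (load rest) (potential i w) ⟩
      load rest + (freshLoad i j w + potential i w)
        ≡⟨ cong (load rest +_) (potential-exchange i j w) ⟩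
      load rest + (potential (suc i) w′ + dropped i w′)
        ≡⟨ ℚₚ.+-assoc (load rest) (potential (suc i) w′) (dropped i w′) ⟨
      (load rest + potential (suc i) w′) + dropped i w′
        ≤⟨ ℚₚ.+-mono-≤ (load-potential-≤ (suc i) r w′ (drop-∷ i ls eq) (Capped-suc capped′)) (dropped-≤ i w′ capped′) ⟩
      cost ℓ * harmonic (inc (suc i) ℓ) + cost ℓ * (count (leaves i) · x)
        ≡⟨ ℚₚ.*-distribˡ-+ (cost ℓ) (harmonic (inc (suc i) ℓ)) (count (leaves i) · x) ⟨
      cost ℓ * (harmonic (inc (suc i) ℓ) + count (leaves i) · x)
        ≤⟨ *-monoˡ-≤-nonneg (costNonneg ℓ) (harmonic-gap (inc (suc i) ℓ) (count (leaves i)) (inc i ℓ) leaves-count) ⟩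
      cost ℓ * harmonic (inc i ℓ)
        ∎
      where
      open ℚₚ.≤-Reasoning
      w′ = reweight i j w
      rest = go (suc i) r w′
      x = inv-suc (inc i ℓ ∸ 1)
      capped′ : Capped i w′
      capped′ = reweight-capped eq capped
      leaves-count : inc (suc i) ℓ ℕ.+ count (leaves i) ≡ inc i ℓ
      leaves-count = sym (count-split (incident i ℓ) (incident (suc i) ℓ) (incident-antimono (ℕₚ.n≤1+n i)))

    dualLoad-≤ : dualLoad ℓ ≤ℚ cost ℓ * harmonic (inc 0 ℓ)
    dualLoad-≤ = begin
      dualLoad ℓ                              ≡⟨ ℚₚ.+-identityʳ (dualLoad ℓ) ⟨
      load entries + 0ℚ                       ≡⟨ cong (load entries +_) no-potential ⟨
      load entries + potential 0 (λ _ → 0ℚ)   ≤⟨ load-potential-≤ 0 ls (λ _ → 0ℚ) refl zero-capped ⟩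
      cost ℓ * harmonic (inc 0 ℓ)             ∎
      where
      open ℚₚ.≤-Reasoning
      no-potential : potential 0 (λ _ → 0ℚ) ≡ 0ℚ
      no-potential = sumℚ-map-zero _ (λ u → if-eta (incident 0 ℓ u)) (allFin n)
      zero-capped : Capped 0 (λ _ → 0ℚ)
      zero-capped _ = ratio-nonneg (inc 0 ℓ) (costNonneg ℓ)

    inc₀-≤ : ∀ {λ'} → (∀ xs → IsPath tr (proj₁ (link ℓ)) (proj₂ (link ℓ)) xs → length xs ∸ 1 ≤ λ') →
      inc 0 ℓ ≤ λ' ∸ 1
    inc₀-≤ paths-≤ = separators-count-≤ (incident 0 ℓ) (proj₁ spanning) paths-≤
      (λ {u} ℓ∋u → Separates-antimono (xs⊆xs++ys tr (F 0)) (crosses⇒separates {0} (proj₂ (to (T-∧ {nonleaf tr u}) ℓ∋u))))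

lemma3p3 : (I : Instance) → Is2NCTAP I → (λ' : ℕ) → IsMaxTreePathLength I λ' →
    (ls : List (Fin (Instance.m I))) → Greedy.IsGreedyRun I ls →
    (∀ (u : Fin (Instance.n I)) (P : Fin (Instance.n I) → Fin (Instance.n I) → Bool) →
        Greedy.InΠ I ls u P → 0ℚ ≤ℚ Greedy.y I ls u P)
    × (∀ (j : Fin (Instance.m I)) →
        Greedy.dualLoad I ls j ≤ℚ harmonic (λ' ∸ 1) * Instance.cost I j)
lemma3p3 I isI λ' (paths-≤ , _) ls run = (λ u P _ → y-nonneg u P) , load-bound
  where
  open Instance I
  open GreedyRun isI run
  load-bound : ∀ ℓ → Greedy.dualLoad I ls ℓ ≤ℚ harmonic (λ' ∸ 1) * cost ℓ
  load-bound ℓ = begin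
    Greedy.dualLoad I ls ℓ       ≤⟨ dualLoad-≤ ℓ ⟩
    cost ℓ * harmonic (inc 0 ℓ)  ≤⟨ *-monoˡ-≤-nonneg (Is2NCTAP.costNonneg isI ℓ) (harmonic-mono-≤ (inc₀-≤ ℓ (paths-≤ ℓ))) ⟩
    cost ℓ * harmonic (λ' ∸ 1)   ≡⟨ ℚₚ.*-comm (cost ℓ) (harmonic (λ' ∸ 1)) ⟩
    harmonic (λ' ∸ 1) * cost ℓ   ∎
    where
    open ℚₚ.≤-Reasoning
    open Greedy I ls using (inc)
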